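{- Let $N$ be a positive integer, let $A, B$ be integers with $0 \le A, B < N$, and put $X = A\cdot B$. Let $G$ and $H$ be positive integers with $G < H$ satisfying $$N^2 \le G\cdot H \quad\text{and}\quad G < N .$$ Define $\mu = \lfloor G\cdot H / N \rfloor$ and the estimated quotient $\hat Q = \big\lfloor \lfloor X/G \rfloor \cdot \mu / H \big\rfloor$, and let $Q = \lfloor X/N \rfloor$ be the actual quotient of $X$ divided by $N$. Then $|Q - \hat Q| \le 2$, i.e. the estimated quotient is at most $2$ away from the actual quotient.
   Context: $\lfloor y \rfloor$ denotes the floor (integer part) of a real number $y$. The quantity $\hat Q$ is the quotient estimate produced by a generalized Barrett algorithm in which the usual powers of two are replaced by arbitrary positive integers $G$ and $H$ (no coprimality of $G$ and $H$ is assumed). -}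

module Defs where

open import Data.Nat using (ℕ; _*_; _/_; NonZero)

barrettMu : (G H N : ℕ) → .{{NonZero N}} → ℕ
barrettMu G H N = (G * H) / N

barrettQhat : (X G H N : ℕ) → .{{NonZero G}} → .{{NonZero H}} → .{{NonZero N}} → ℕ
barrettQhat X G H N = ((X / G) * barrettMu G H N) / H

{-# OPTIONS --safe #-}
module Submission where

open import Defs
open import Data.List using ([]; _∷_)
open import Data.Nat using (ℕ; suc; _*_; _/_; _%_; _+_; _≤_; _<_; NonZero)
open import Data.Nat.DivMod using (m≡m%n+[m/n]*n; m%n<n; m/n*n≤m; m*n/n≡m; /-monoˡ-≤; m<n*o⇒m/o<n)
open import Data.Nat.Properties
open import Data.Nat.Tactic.RingSolver using (solve)
open import Data.Product using (_×_; _,_)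
open import Relation.Binary.PropositionalEquality using (_≡_; refl; sym)

-- Write a = ⌊X/G⌋ and μ = ⌊GH/N⌋, so that Q̂ = ⌊aμ/H⌋. Since aG ≤ X and μN ≤ GH,
-- aμ ≤ XH/N, whence Q̂ ≤ Q. Conversely, expanding X = aG + r and GH = μN + s gives
-- X·GH ≤ GN·aμ + X·s + r·GH; with X ≤ GH, s < N and r < G ≤ N the last two terms are
-- each below GH·N, so X < (Q̂ + 3)N and Q ≤ Q̂ + 2.

m*n≤o⇒m≤o/n : ∀ m n o .{{_ : NonZero n}} → m * n ≤ o → m ≤ o / n
m*n≤o⇒m≤o/n m n o m*n≤o = begin
  m         ≡⟨ sym (m*n/n≡m m n) ⟩
  m * n / n ≤⟨ /-monoˡ-≤ n m*n≤o ⟩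
  o / n     ∎
  where open ≤-Reasoning

m<[1+m/n]*n : ∀ m n .{{_ : NonZero n}} → m < suc (m / n) * n
m<[1+m/n]*n m n = begin-strict
  m                 ≡⟨ m≡m%n+[m/n]*n m n ⟩
  m % n + m / n * n <⟨ +-monoˡ-< (m / n * n) (m%n<n m n) ⟩
  n + m / n * n     ∎
  where open ≤-Reasoning

*-expand-divMod : ∀ m n d e .{{_ : NonZero d}} .{{_ : NonZero e}} →
                  m * n + m % d * (n % e) ≡ d * e * (m / d * (n / e)) + m * (n % e) + m % d * n
*-expand-divMod m n d e = expand (m / d) (m % d) (n / e) (n % e) (m≡m%n+[m/n]*n m d) (m≡m%n+[m/n]*n n e)
  where
  expand : ∀ {m n} a r b s → m ≡ r + a * d → n ≡ s + b * e →
           m * n + r * s ≡ d * e * (a * b) + m * s + r * n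
  expand a r b s refl refl = solve (a ∷ r ∷ b ∷ s ∷ d ∷ e ∷ [])

estimates⇒q*N≤X : ∀ {X G H N a μ q} .{{_ : NonZero G}} .{{_ : NonZero H}} →
                   a * G ≤ X → μ * N ≤ G * H → q * H ≤ a * μ → q * N ≤ X
estimates⇒q*N≤X {X} {G} {H} {N} {a} {μ} {q} aG≤X μN≤GH qH≤aμ =
  *-cancelʳ-≤ (q * N) X H (begin
    q * N * H   ≡⟨ solve (q ∷ N ∷ H ∷ []) ⟩
    q * H * N   ≤⟨ *-monoˡ-≤ N qH≤aμ ⟩
    a * μ * N   ≤⟨ aμN≤XH ⟩
    X * H       ∎)
  where
  open ≤-Reasoning
  aμN≤XH : a * μ * N ≤ X * H
  aμN≤XH = *-cancelʳ-≤ (a * μ * N) (X * H) G (begin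
    a * μ * N * G     ≡⟨ solve (a ∷ μ ∷ N ∷ G ∷ []) ⟩
    a * G * (μ * N)   ≤⟨ *-mono-≤ aG≤X μN≤GH ⟩
    X * (G * H)       ≡⟨ solve (X ∷ G ∷ H ∷ []) ⟩
    X * H * G         ∎)

barrettQhat≤quotient : ∀ X G H N .{{_ : NonZero G}} .{{_ : NonZero H}} .{{_ : NonZero N}} →
                       barrettQhat X G H N ≤ X / N
barrettQhat≤quotient X G H N = m*n≤o⇒m≤o/n q N X
  (estimates⇒q*N≤X {N = N} {a} {μ} {q} (m/n*n≤m X G) (m/n*n≤m (G * H) N) (m/n*n≤m (a * μ) H))
  where
  a = X / G
  μ = barrettMu G H N
  q = barrettQhat X G H N

quotient≤barrettQhat+2 : ∀ X G H N .{{_ : NonZero G}} .{{_ : NonZero H}} .{{_ : NonZero N}} →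
                         X ≤ G * H → G ≤ N → X / N ≤ barrettQhat X G H N + 2
quotient≤barrettQhat+2 X G H N X≤P G≤N =
  ≤-trans (≤-pred (m<n*o⇒m/o<n X<[3+q]*N)) (≤-reflexive (+-comm 2 q))
  where
  open ≤-Reasoning
  P = G * H
  a = X / G
  μ = barrettMu G H N
  q = barrettQhat X G H N
  instance
    P≢0 : NonZero P
    P≢0 = m*n≢0 G H
    GN≢0 : NonZero (G * N)
    GN≢0 = m*n≢0 G N
  aμ<[1+q]*H : a * μ < suc q * H
  aμ<[1+q]*H = m<[1+m/n]*n (a * μ) H
  X*[P%N]<P*N : X * (P % N) < P * N
  X*[P%N]<P*N = ≤-<-trans (*-monoˡ-≤ (P % N) X≤P) (*-monoʳ-< P (m%n<n P N))
  [X%G]*P<N*P : X % G * P < N * P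
  [X%G]*P<N*P = *-monoˡ-< P (<-≤-trans (m%n<n X G) G≤N)
  regroup : ∀ g h n k → g * n * (suc k * h) + g * h * n + n * (g * h) ≡ (3 + k) * n * (g * h)
  regroup g h n k = solve (g ∷ h ∷ n ∷ k ∷ [])
  X<[3+q]*N : X < (3 + q) * N
  X<[3+q]*N = *-cancelʳ-< P X ((3 + q) * N) (begin-strict
    X * P                                         ≤⟨ m≤m+n (X * P) (X % G * (P % N)) ⟩
    X * P + X % G * (P % N)                       ≡⟨ *-expand-divMod X P G N ⟩
    G * N * (a * μ) + X * (P % N) + X % G * P     <⟨ +-mono-< (+-mono-< (*-monoʳ-< (G * N) aμ<[1+q]*H) X*[P%N]<P*N) [X%G]*P<N*P ⟩
    G * N * (suc q * H) + P * N + N * P           ≡⟨ regroup G H N q ⟩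
    (3 + q) * N * P                               ∎)

theorem1 : (N A B G H : ℕ) → .{{_ : NonZero N}} → .{{_ : NonZero G}} → .{{_ : NonZero H}}
    → A < N → B < N → G < H → N * N ≤ G * H → G < N
    → let X = A * B
          Q = X / N
          Qhat = barrettQhat X G H N
      in (Q ≤ Qhat + 2) × (Qhat ≤ Q + 2)
theorem1 N A B G H A<N B<N _ N*N≤G*H G<N =
    quotient≤barrettQhat+2 (A * B) G H N A*B≤G*H (<⇒≤ G<N)
  , ≤-trans (barrettQhat≤quotient (A * B) G H N) (m≤m+n (A * B / N) 2)
  where
  A*B≤G*H : A * B ≤ G * H
  A*B≤G*H = ≤-trans (*-mono-≤ (<⇒≤ A<N) (<⇒≤ B<N)) N*N≤G*H
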